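{- In two-pile Sharing Nim, the first player to move has a winning strategy if the starting position has nonzero nim-sum, and the second player has a winning strategy if the starting position has nim-sum $0$; the winning strategy is the same as in ordinary two-pile Nim, namely always to move to a position of nim-sum $0$.
   Context: Sharing Nim (here with 2 piles): a position is a tuple of nonnegative integers (pile sizes). Two players alternate moves. A move is either (a) removing a positive number of objects from one pile, or (b) transferring a positive number of objects from one pile to another pile, subject to the restriction that objects may not be transferred from a pile of greater size to a pile of smaller size. The player who removes the last object wins (a player with no legal move loses). The nim-sum is the bitwise exclusive-or of the pile sizes. In ordinary Nim a move consists only of removing a positive number of objects from one pile. -}

module Defs where

open import Data.Nat using (ℕ; zero; suc; _+_; _*_; _∸_; _≤_; _<_; _/_; _%_)
open import Data.Bool using (Bool; true; false; _xor_)
open import Data.Product using (_×_; _,_; Σ)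

Pos : Set
Pos = ℕ × ℕ

bit : ℕ → Bool
bit n with n % 2
... | zero = false
... | suc _ = true

fromBool : Bool → ℕ
fromBool false = 0
fromBool true  = 1

-- xor with fuel; fuel a + b is always enough (a number n has at most n bits).
xorF : ℕ → ℕ → ℕ → ℕ
xorF zero    a b = 0
xorF (suc f) a b = fromBool (bit a xor bit b) + 2 * xorF f (a / 2) (b / 2)

_⊕_ : ℕ → ℕ → ℕ
a ⊕ b = xorF (a + b) a b

nimSum : Pos → ℕ
nimSum (a , b) = a ⊕ b

data Move : Pos → Pos → Set where
  remove₁   : ∀ {a b} k → 1 ≤ k → k ≤ a → Move (a , b) (a ∸ k , b)
  remove₂   : ∀ {a b} k → 1 ≤ k → k ≤ b → Move (a , b) (a , b ∸ k)
  transfer₁₂ : ∀ {a b} k → 1 ≤ k → k ≤ a → a ≤ b → Move (a , b) (a ∸ k , b + k)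
  transfer₂₁ : ∀ {a b} k → 1 ≤ k → k ≤ b → b ≤ a → Move (a , b) (a + k , b ∸ k)

-- Winning strategies following a given rule.
-- `WinBy Z p`: the player to move at p wins by always moving to a position
-- satisfying Z (normal play: a player with no legal move loses).
-- `LoseBy Z p`: the player NOT to move at p (the second player) wins by
-- always moving to a position satisfying Z, whatever the opponent does.
-- These are inductive, so every play consistent with the strategy is finite
-- and ends with the strategy's user making the last move.

mutual
  data WinBy (Z : Pos → Set) (p : Pos) : Set where
    win : (q : Pos) → Move p q → Z q → LoseBy Z q → WinBy Z p

  data LoseBy (Z : Pos → Set) (p : Pos) : Set where
    lose : ((q : Pos) → Move p q → WinBy Z q) → LoseBy Z p

-- A position (a , b) has nim-sum 0 exactly when a ≡ b. From an unequal position the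
-- player to move restores equality by shrinking the larger pile. From an equal
-- position (a , a) every move, whether a removal or a transfer (only k ≤ a objects can
-- leave a pile), leaves one pile a ∸ k < a and the other at least a; so the opponent
-- can again equalise, to the strictly smaller diagonal position (a ∸ k , a ∸ k), and
-- induction on the pile size finishes the argument.
module Submission where

open import Defs
open import Data.Nat using (ℕ; zero; suc; _+_; _*_; _∸_; _≤_; _<_; _/_; _%_; z≤n; s≤s)
open import Data.Nat.Properties
open import Data.Nat.DivMod using (m≡m%n+[m/n]*n; m%n<n; m/n<m; /-monoˡ-≤)
open import Data.Nat.Induction using (<-rec)
open import Data.Bool using (true; false; _xor_)
open import Data.Bool.Properties using (xor-same)
open import Data.Product using (_×_; _,_)
open import Data.Empty using (⊥-elim)
open import Relation.Binary.Definitions using (tri<; tri≈; tri>)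
open import Relation.Binary.PropositionalEquality

xorF-same : ∀ f a → xorF f a a ≡ 0
xorF-same zero    a = refl
xorF-same (suc f) a rewrite xor-same (bit a) | xorF-same f (a / 2) = refl

⊕-same : ∀ a → a ⊕ a ≡ 0
⊕-same a = xorF-same (a + a) a

fromBool≡0⇒≡false : ∀ {x} → fromBool x ≡ 0 → x ≡ false
fromBool≡0⇒≡false {false} _ = refl

xor≡false⇒≡ : ∀ x y → x xor y ≡ false → x ≡ y
xor≡false⇒≡ true  true  _ = refl
xor≡false⇒≡ false false _ = refl

fromBool-bit : ∀ n → fromBool (bit n) ≡ n % 2
fromBool-bit n with n % 2 | m%n<n n 2
... | zero        | _ = refl
... | suc zero    | _ = refl
... | suc (suc _) | s≤s (s≤s ())

bit≡⇒%2≡ : ∀ a b → bit a ≡ bit b → a % 2 ≡ b % 2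
bit≡⇒%2≡ a b eq =
  trans (sym (fromBool-bit a)) (trans (cong fromBool eq) (fromBool-bit b))

%2≡∧/2≡⇒≡ : ∀ {a b} → a % 2 ≡ b % 2 → a / 2 ≡ b / 2 → a ≡ b
%2≡∧/2≡⇒≡ {a} {b} low high = begin
  a                   ≡⟨ m≡m%n+[m/n]*n a 2 ⟩
  a % 2 + (a / 2) * 2 ≡⟨ cong₂ (λ r q → r + q * 2) low high ⟩
  b % 2 + (b / 2) * 2 ≡⟨ m≡m%n+[m/n]*n b 2 ⟨
  b                   ∎
  where open ≡-Reasoning

/2-≤-pred : ∀ {a f} → a ≤ suc f → a / 2 ≤ f
/2-≤-pred {a} {f} a≤1+f =
  ≤-pred (≤-<-trans (/-monoˡ-≤ 2 a≤1+f) (m/n<m (suc f) 2 (s≤s (s≤s z≤n))))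

-- The bound a , b ≤ f says the fuel suffices: with too little fuel xorF truncates and
-- may vanish on unequal arguments.
xorF≡0⇒≡ : ∀ f {a b} → a ≤ f → b ≤ f → xorF f a b ≡ 0 → a ≡ b
xorF≡0⇒≡ zero    a≤0 b≤0 _ = trans (n≤0⇒n≡0 a≤0) (sym (n≤0⇒n≡0 b≤0))
xorF≡0⇒≡ (suc f) {a} {b} a≤ b≤ eq = %2≡∧/2≡⇒≡ parity halves
  where
  low high : ℕ
  low  = fromBool (bit a xor bit b)
  high = xorF f (a / 2) (b / 2)

  parity : a % 2 ≡ b % 2
  parity = bit≡⇒%2≡ a b (xor≡false⇒≡ (bit a) (bit b) (fromBool≡0⇒≡false (m+n≡0⇒m≡0 low eq)))

  halves : a / 2 ≡ b / 2
  halves = xorF≡0⇒≡ f (/2-≤-pred a≤) (/2-≤-pred b≤)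
             (m+n≡0⇒m≡0 high (m+n≡0⇒n≡0 low eq))

⊕≡0⇒≡ : ∀ {a b} → a ⊕ b ≡ 0 → a ≡ b
⊕≡0⇒≡ {a} {b} = xorF≡0⇒≡ (a + b) (m≤m+n a b) (m≤n+m b a)

Balanced : Pos → Set
Balanced q = nimSum q ≡ 0

reduce₁ : ∀ {a b m} → m < a → Move (a , b) (m , b)
reduce₁ {a} {b} {m} m<a =
  subst (λ x → Move (a , b) (x , b)) (m∸[m∸n]≡n (<⇒≤ m<a))
        (remove₁ (a ∸ m) (m<n⇒0<n∸m m<a) (m∸n≤m a m))

reduce₂ : ∀ {a b m} → m < b → Move (a , b) (a , m)
reduce₂ {a} {b} {m} m<b =
  subst (λ x → Move (a , b) (a , x)) (m∸[m∸n]≡n (<⇒≤ m<b))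
        (remove₂ (b ∸ m) (m<n⇒0<n∸m m<b) (m∸n≤m b m))

winBy-reduce₁ : ∀ {a m} → m < a → LoseBy Balanced (m , m) → WinBy Balanced (a , m)
winBy-reduce₁ {m = m} m<a = win (m , m) (reduce₁ m<a) (⊕-same m)

winBy-reduce₂ : ∀ {b m} → m < b → LoseBy Balanced (m , m) → WinBy Balanced (m , b)
winBy-reduce₂ {m = m} m<b = win (m , m) (reduce₂ m<b) (⊕-same m)

∸-<-self : ∀ {a k} → 1 ≤ k → k ≤ a → a ∸ k < a
∸-<-self {a} 1≤k k≤a = ∸-monoʳ-< {a} {o = 0} 1≤k k≤a

loseBy-diagonal : ∀ a → LoseBy Balanced (a , a)
loseBy-diagonal = <-rec (λ a → LoseBy Balanced (a , a)) step
  where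
  step : ∀ a → (∀ {m} → m < a → LoseBy Balanced (m , m)) → LoseBy Balanced (a , a)
  step a ih = lose reply
    where
    reply : ∀ q → Move (a , a) q → WinBy Balanced q
    reply _ (remove₁ k 1≤k k≤a) =
      winBy-reduce₂ (∸-<-self 1≤k k≤a) (ih (∸-<-self 1≤k k≤a))
    reply _ (remove₂ k 1≤k k≤a) =
      winBy-reduce₁ (∸-<-self 1≤k k≤a) (ih (∸-<-self 1≤k k≤a))
    reply _ (transfer₁₂ k 1≤k k≤a _) =
      winBy-reduce₂ (<-≤-trans (∸-<-self 1≤k k≤a) (m≤m+n a k)) (ih (∸-<-self 1≤k k≤a))
    reply _ (transfer₂₁ k 1≤k k≤a _) =
      winBy-reduce₁ (<-≤-trans (∸-<-self 1≤k k≤a) (m≤m+n a k)) (ih (∸-<-self 1≤k k≤a))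

winBy-off-diagonal : ∀ a b → a ≢ b → WinBy Balanced (a , b)
winBy-off-diagonal a b a≢b with <-cmp a b
... | tri< a<b _ _ = winBy-reduce₂ a<b (loseBy-diagonal a)
... | tri≈ _ a≡b _ = ⊥-elim (a≢b a≡b)
... | tri> _ _ b<a = winBy-reduce₁ b<a (loseBy-diagonal b)

theorem5p3 : (p : Pos)
    → (nimSum p ≢ 0 → WinBy (λ q → nimSum q ≡ 0) p)
    × (nimSum p ≡ 0 → LoseBy (λ q → nimSum q ≡ 0) p)
theorem5p3 (a , b) = winning , losing
  where
  winning : a ⊕ b ≢ 0 → WinBy Balanced (a , b)
  winning nonzero = winBy-off-diagonal a b (λ { refl → nonzero (⊕-same a) })

  losing : a ⊕ b ≡ 0 → LoseBy Balanced (a , b)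
  losing a⊕b≡0 =
    subst (λ x → LoseBy Balanced (a , x)) (⊕≡0⇒≡ a⊕b≡0) (loseBy-diagonal a)
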